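{- Let $G$ be an infinite (countable) graph and let $h:\mathbb{N}\to\mathbb{N}$. Then $h$ is online computable from the isomorphism type of $G$ if and only if $h$ is primitive recursive.
   Context: A presentation of $G$ is a graph isomorphic to $G$ with vertex set $\mathbb{N}$. It is coded as an infinite string $\alpha$ such that for each $n$ the initial segment $\alpha\upharpoonright n$ (under a fixed primitive recursive coding) describes the finite induced subgraph on the first $n$ vertices; the possible one-step extensions of $\alpha\upharpoonright n$ are the finitely many graphs on $n+1$ vertices extending it, so the space of such codes is primitively recursively branching. The function $h$ is online computable from the isomorphism type of $G$ if there exist a primitive recursive function $u$ and a primitive recursive function $F$, taking a finite string and a number $i$ as input, such that for every presentation $\alpha$ of $G$ and every $i$, $h(i)=F(\alpha\upharpoonright u(i), i)$ (written $f^{\alpha\upharpoonright u(i)}(i)$); that is, $h$ is computed by one fixed primitive recursive online procedure using any presentation of $G$ as oracle. -}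

module Defs where

open import Data.Nat using (ℕ; zero; suc; _+_; _*_; _^_)
open import Data.Bool using (Bool; true; false)
open import Data.Fin using (Fin)
open import Data.Vec using (Vec; []; _∷_; lookup; map)
open import Data.Product using (Σ; _×_)
open import Relation.Binary.PropositionalEquality using (_≡_)
open import Function.Bundles using (_↔_; Inverse)

data PR : ℕ → Set where
  pr-zero : PR 0
  pr-succ : PR 1
  pr-proj : ∀ {n} → Fin n → PR n
  pr-comp : ∀ {m n} → PR m → Vec (PR n) m → PR n
  pr-rec  : ∀ {n} → PR n → PR (suc (suc n)) → PR (suc n)

mutual
  eval : ∀ {n} → PR n → Vec ℕ n → ℕ
  eval pr-zero        xs         = 0
  eval pr-succ        (x ∷ [])   = suc x
  eval (pr-proj i)    xs         = lookup xs i
  eval (pr-comp f gs) xs         = eval f (evalAll gs xs)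
  eval (pr-rec g h)   (zero  ∷ xs) = eval g xs
  eval (pr-rec g h)   (suc k ∷ xs) = eval h (eval (pr-rec g h) (k ∷ xs) ∷ k ∷ xs)

  evalAll : ∀ {m n} → Vec (PR n) m → Vec ℕ n → Vec ℕ m
  evalAll []       xs = []
  evalAll (g ∷ gs) xs = eval g xs ∷ evalAll gs xs

PrimitiveRecursive : (ℕ → ℕ) → Set
PrimitiveRecursive h = Σ (PR 1) λ c → ∀ i → h i ≡ eval c (i ∷ [])

record Graph : Set where
  field
    adj     : ℕ → ℕ → Bool
    adj-sym : ∀ x y → adj x y ≡ adj y x
    adj-irr : ∀ x → adj x x ≡ false
open Graph public

_≅_ : Graph → Graph → Set
G ≅ H = Σ (ℕ ↔ ℕ) λ f →
  ∀ x y → adj G x y ≡ adj H (Inverse.to f x) (Inverse.to f y)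

Presentation : Graph → Set
Presentation G = Σ Graph λ α → α ≅ G

-- Fixed primitive recursive coding of the initial segment α↾n
-- (the induced subgraph on vertices 0,…,n-1) as a natural number.
-- code 0 = 1 (leading marker bit), and
-- code (n+1) = code n * 2^n + Σ_{j<n} [adj j n] * 2^j,
-- i.e. the binary expansion is a 1 followed by the adjacency bits,
-- row by row; it determines n and the finite graph.

bit : Bool → ℕ
bit true  = 1
bit false = 0

row : (ℕ → ℕ → Bool) → ℕ → ℕ → ℕ
row a n zero    = 0
row a n (suc j) = row a n j + bit (a j n) * 2 ^ j

code : (ℕ → ℕ → Bool) → ℕ → ℕ
code a zero    = 1
code a (suc n) = code a n * 2 ^ n + row a n n

restrict : Graph → ℕ → ℕ
restrict α n = code (adj α) n

OnlineComputable : Graph → (ℕ → ℕ) → Set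
OnlineComputable G h =
  Σ (PR 1) λ u → Σ (PR 2) λ F →
    (α : Presentation G) (i : ℕ) →
      h i ≡ eval F (restrict (Σ.proj₁ α) (eval u (i ∷ [])) ∷ i ∷ [])

-- If h is primitive recursive it is trivially online computable: ignore the
-- presentation.  Conversely, let u and F witness online computability.  By
-- the infinite Ramsey theorem (the only classical step, using excluded middle)
-- G contains an infinite homogeneous set v₀ < v₁ < ⋯ : all pairs are adjacent
-- (b = true) or all are non-adjacent (b = false).  For every n, relabelling G
-- by a permutation of ℕ sending j ↦ vⱼ for j < n gives a presentation whose
-- initial segment of length n is the complete (resp. empty) graph on n
-- vertices, whose code is a primitive recursive function of n.  Hence
-- h(i) = F(code_b(u(i)), i) is primitive recursive.

module Submission where

open import Defs
open import Data.Nat using (ℕ; zero; suc; _+_; _*_; _^_; _≤_; _<_; _≤′_; ≤′-refl; ≤′-step)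
open import Data.Nat.Properties
open import Data.Bool using (Bool; true; false)
open import Data.Bool.Properties using (¬-not)
open import Data.Fin using () renaming (zero to fz; suc to fs)
open import Data.Vec using ([]; _∷_)
open import Data.Product using (Σ; _×_; _,_; proj₁; proj₂)
open import Data.Sum using (inj₁; inj₂)
open import Data.Empty using (⊥-elim)
open import Data.Unit using (⊤; tt)
open import Relation.Nullary using (¬_; yes; no)
open import Relation.Binary.Core using (_Preserves_⟶_)
open import Relation.Binary.Definitions using (tri<; tri≈; tri>)
open import Relation.Binary.PropositionalEquality
open import Level using (0ℓ)
open import Axiom.ExcludedMiddle using (ExcludedMiddle)
open import Axiom.DoubleNegationElimination using (em⇒dne)
open import Function.Definitions using (Injective)
open import Function.Bundles using (_⇔_; mk⇔; _↔_; mk↔ₛ′; Inverse; Injection)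
open import Function.Construct.Identity using (↔-id)
open import Function.Construct.Composition using (_↔-∘_)
open import Function.Properties.Inverse using (↔⇒↣)

open ≡-Reasoning

#0 : ∀ {n} → PR (suc n)
#0 = pr-proj fz

#1 : ∀ {n} → PR (suc (suc n))
#1 = pr-proj (fs fz)

#2 : ∀ {n} → PR (suc (suc (suc n)))
#2 = pr-proj (fs (fs fz))

app₁ : ∀ {n} → PR 1 → PR n → PR n
app₁ f g = pr-comp f (g ∷ [])

app₂ : ∀ {n} → PR 2 → PR n → PR n → PR n
app₂ f g k = pr-comp f (g ∷ k ∷ [])

zeroP : ∀ {n} → PR n
zeroP = pr-comp pr-zero []

oneP : PR 0
oneP = app₁ pr-succ pr-zero

addP : PR 2
addP = pr-rec #0 (app₁ pr-succ #0)

addP-ok : ∀ x y → eval addP (x ∷ y ∷ []) ≡ x + y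
addP-ok zero    y = refl
addP-ok (suc x) y = cong suc (addP-ok x y)

mulP : PR 2
mulP = pr-rec zeroP (app₂ addP #2 #0)

mulP-ok : ∀ x y → eval mulP (x ∷ y ∷ []) ≡ x * y
mulP-ok zero    y = refl
mulP-ok (suc x) y = trans (addP-ok y _) (cong (y +_) (mulP-ok x y))

powP : PR 1
powP = pr-rec oneP (app₂ addP #0 #0)

powP-ok : ∀ n → eval powP (n ∷ []) ≡ 2 ^ n
powP-ok zero    = refl
powP-ok (suc n) = begin
  eval powP (suc n ∷ [])                   ≡⟨ addP-ok (eval powP (n ∷ [])) _ ⟩
  eval powP (n ∷ []) + eval powP (n ∷ [])  ≡⟨ cong (λ z → z + z) (powP-ok n) ⟩
  2 ^ n + 2 ^ n                            ≡⟨ cong (2 ^ n +_) (sym (+-identityʳ (2 ^ n))) ⟩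
  2 ^ suc n                                ∎

termP : Bool → PR 1
termP true  = powP
termP false = zeroP

termP-ok : ∀ b j → eval (termP b) (j ∷ []) ≡ bit b * 2 ^ j
termP-ok true  j = trans (powP-ok j) (sym (*-identityˡ (2 ^ j)))
termP-ok false j = refl

rowP : Bool → PR 1
rowP b = pr-rec pr-zero (app₂ addP #0 (app₁ (termP b) #1))

rowP-ok : ∀ b n j → eval (rowP b) (j ∷ []) ≡ row (λ _ _ → b) n j
rowP-ok b n zero    = refl
rowP-ok b n (suc j) =
  trans (addP-ok (eval (rowP b) (j ∷ [])) _) (cong₂ _+_ (rowP-ok b n j) (termP-ok b j))

codeP : Bool → PR 1
codeP b = pr-rec oneP (app₂ addP (app₂ mulP #0 (app₁ powP #1)) (app₁ (rowP b) #1))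

codeP-ok : ∀ b n → eval (codeP b) (n ∷ []) ≡ code (λ _ _ → b) n
codeP-ok b zero    = refl
codeP-ok b (suc n) = begin
  eval (codeP b) (suc n ∷ [])                  ≡⟨ addP-ok (eval mulP (previous ∷ pow ∷ [])) _ ⟩
  eval mulP (previous ∷ pow ∷ []) + rest       ≡⟨ cong (_+ rest) (mulP-ok previous pow) ⟩
  previous * pow + rest                        ≡⟨ cong₂ _+_ (cong₂ _*_ (codeP-ok b n) (powP-ok n))
                                                            (rowP-ok b n n) ⟩
  code (λ _ _ → b) (suc n)                     ∎
  where
  previous = eval (codeP b) (n ∷ [])
  pow      = eval powP (n ∷ [])
  rest     = eval (rowP b) (n ∷ [])

row-cong : ∀ (a a′ : ℕ → ℕ → Bool) n j →
  (∀ i → i < j → a i n ≡ a′ i n) → row a n j ≡ row a′ n j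
row-cong a a′ n zero    same = refl
row-cong a a′ n (suc j) same = cong₂ _+_
  (row-cong a a′ n j (λ i i<j → same i (m<n⇒m<1+n i<j)))
  (cong (λ z → bit z * 2 ^ j) (same j (n<1+n j)))

code-cong : ∀ (a a′ : ℕ → ℕ → Bool) n →
  (∀ i m → i < m → m < n → a i m ≡ a′ i m) → code a n ≡ code a′ n
code-cong a a′ zero    same = refl
code-cong a a′ (suc n) same = cong₂ _+_
  (cong (_* 2 ^ n) (code-cong a a′ n (λ i m i<m m<n → same i m i<m (m<n⇒m<1+n m<n))))
  (row-cong a a′ n n (λ i i<n → same i n i<n (n<1+n n)))

Infinite : (ℕ → Set) → Set
Infinite X = ∀ m → Σ ℕ λ y → m ≤ y × X y

infinite-above : ∀ {X} → Infinite X → ∀ p → Infinite (λ y → X y × p < y)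
infinite-above inf p m =
  let (y , m+1+p≤y , Xy) = inf (m + suc p)
  in y , ≤-trans (m≤m+n m (suc p)) m+1+p≤y , Xy , ≤-trans (m≤n+m (suc p) m) m+1+p≤y

stepwise-increasing : (t : ℕ → ℕ) → (∀ j → t j < t (suc j)) → t Preserves _<_ ⟶ _<_
stepwise-increasing t step j<k = go (≤⇒≤′ j<k)
  where
  go : ∀ {j k} → suc j ≤′ k → t j < t k
  go ≤′-refl       = step _
  go (≤′-step j<k) = <-trans (go j<k) (step _)

enumerate : ∀ {X} → Infinite X →
  Σ (ℕ → ℕ) λ t → (∀ j → X (t j)) × t Preserves _<_ ⟶ _<_
enumerate {X} inf = t , member , stepwise-increasing t step
  where
  t : ℕ → ℕ
  t zero    = proj₁ (inf 0)
  t (suc j) = proj₁ (inf (suc (t j)))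

  member : ∀ j → X (t j)
  member zero    = proj₂ (proj₂ (inf 0))
  member (suc j) = proj₂ (proj₂ (inf (suc (t j))))

  step : ∀ j → t j < t (suc j)
  step j = proj₁ (proj₂ (inf (suc (t j))))

increasing⇒injective : (t : ℕ → ℕ) → t Preserves _<_ ⟶ _<_ → Injective _≡_ _≡_ t
increasing⇒injective t inc {j} {k} tj≡tk with <-cmp j k
... | tri< j<k _ _ = ⊥-elim (<⇒≢ (inc j<k) tj≡tk)
... | tri≈ _ j≡k _ = j≡k
... | tri> _ _ k<j = ⊥-elim (<⇒≢ (inc k<j) (sym tj≡tk))

record Homogeneous (col : ℕ → ℕ → Bool) (b : Bool) (v : ℕ → ℕ) : Set where
  field
    increasing : v Preserves _<_ ⟶ _<_
    coloured   : ∀ {j k} → j < k → col (v j) (v k) ≡ b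

module Classical (lem : ExcludedMiddle 0ℓ) where

  bounded : ∀ {X} → ¬ Infinite X → Σ ℕ λ m₀ → ∀ y → m₀ ≤ y → ¬ X y
  bounded {X} ¬inf =
    let (m₀ , none) = dne {Σ ℕ λ m₀ → ¬ Σ ℕ λ y → m₀ ≤ y × X y}
                          (λ ¬bound → ¬inf (λ m → dne (λ ¬above → ¬bound (m , ¬above))))
    in m₀ , λ y m₀≤y Xy → none (y , m₀≤y , Xy)
    where dne = em⇒dne lem

  pigeonhole : ∀ {X} → Infinite X → (f : ℕ → Bool) →
    Σ Bool λ b → Infinite (λ y → X y × f y ≡ b)
  pigeonhole {X} inf f with lem {Infinite (λ y → X y × f y ≡ true)}
  ... | yes infTrue = true , infTrue
  ... | no ¬infTrue = false , infFalse
    where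
    infFalse : Infinite (λ y → X y × f y ≡ false)
    infFalse m =
      let (m₀ , none) = bounded ¬infTrue
          (y , m+m₀≤y , Xy) = inf (m + m₀)
      in y , ≤-trans (m≤m+n m m₀) m+m₀≤y , Xy
           , ¬-not (λ fy≡true → none y (≤-trans (m≤n+m m₀ m) m+m₀≤y) (Xy , fy≡true))

  record Reservoir : Set₁ where
    field
      X   : ℕ → Set
      inf : Infinite X
  open Reservoir

  module Construction (col : ℕ → ℕ → Bool) where

    pivot : Reservoir → ℕ
    pivot R = proj₁ (inf R 0)

    pivot∈ : ∀ R → X R (pivot R)
    pivot∈ R = proj₂ (proj₂ (inf R 0))

    refine : (R : Reservoir) →
      Σ Bool λ b → Infinite (λ y → (X R y × pivot R < y) × col (pivot R) y ≡ b)
    refine R = pigeonhole (infinite-above (inf R) (pivot R)) (col (pivot R))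

    stage : ℕ → Reservoir
    stage zero    = record { X = λ _ → ⊤ ; inf = λ m → m , ≤-refl , tt }
    stage (suc k) = record { X = _ ; inf = proj₂ (refine (stage k)) }

    x : ℕ → ℕ
    x k = pivot (stage k)

    c : ℕ → Bool
    c k = proj₁ (refine (stage k))

    nested : ∀ {j k} → j ≤′ k → ∀ {y} → X (stage k) y → X (stage j) y
    nested ≤′-refl        Xy = Xy
    nested (≤′-step j≤′k) Xy = nested j≤′k (proj₁ (proj₁ Xy))

    pivot-pair : ∀ {j k} → j < k → x j < x k × col (x j) (x k) ≡ c j
    pivot-pair {j} {k} j<k =
      let ((_ , xj<xk) , colour) = nested (≤⇒≤′ j<k) (pivot∈ (stage k))
      in xj<xk , colour

  -- Infinite Ramsey theorem: pass to the pivots whose colour c is the one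
  -- taken infinitely often.
  ramsey : (col : ℕ → ℕ → Bool) → Σ Bool λ b → Σ (ℕ → ℕ) (Homogeneous col b)
  ramsey col =
    let (b , infB) = pigeonhole {λ _ → ⊤} (λ m → m , ≤-refl , tt) c
        (t , tB , t-inc) = enumerate infB
    in b , (λ j → x (t j)) , record
      { increasing = λ j<k → proj₁ (pivot-pair (t-inc j<k))
      ; coloured   = λ {j} j<k → trans (proj₂ (pivot-pair (t-inc j<k))) (proj₂ (tB j))
      }
    where open Construction col

swap : ℕ → ℕ → ℕ → ℕ
swap a b x with x ≟ a
... | yes _ = b
... | no _ with x ≟ b
...   | yes _ = a
...   | no _  = x

swap-a : ∀ a b → swap a b a ≡ b
swap-a a b with a ≟ a
... | yes _ = refl
... | no a≢a = ⊥-elim (a≢a refl)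

swap-b : ∀ a b → swap a b b ≡ a
swap-b a b with b ≟ a
... | yes b≡a = b≡a
... | no _ with b ≟ b
...   | yes _ = refl
...   | no b≢b = ⊥-elim (b≢b refl)

swap-other : ∀ a b x → x ≢ a → x ≢ b → swap a b x ≡ x
swap-other a b x x≢a x≢b with x ≟ a
... | yes x≡a = ⊥-elim (x≢a x≡a)
... | no _ with x ≟ b
...   | yes x≡b = ⊥-elim (x≢b x≡b)
...   | no _ = refl

swap-involutive : ∀ a b x → swap a b (swap a b x) ≡ x
swap-involutive a b x with x ≟ a
... | yes refl = swap-b x b
... | no x≢a with x ≟ b
...   | yes refl = swap-a a x
...   | no x≢b = swap-other a b x x≢a x≢b

transposition : ℕ → ℕ → ℕ ↔ ℕ
transposition a b =
  mk↔ₛ′ (swap a b) (swap a b) (swap-involutive a b) (swap-involutive a b)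

-- For an injective v and any n, some permutation of ℕ agrees with v below n:
-- extend the permutation for n by swapping its value at n with v n.
placement : (v : ℕ → ℕ) → Injective _≡_ _≡_ v → ∀ n →
  Σ (ℕ ↔ ℕ) λ π → ∀ {j} → j < n → Inverse.to π j ≡ v j
placement v v-inj zero    = ↔-id ℕ , λ ()
placement v v-inj (suc n) with placement v v-inj n
... | π , π≡v = transposition (to n) (v n) ↔-∘ π , extended
  where
  open Inverse π using (to)

  extended : ∀ {j} → j < suc n → swap (to n) (v n) (to j) ≡ v j
  extended {j} j<1+n with m<1+n⇒m<n∨m≡n j<1+n
  ... | inj₂ refl = swap-a (to n) (v n)
  ... | inj₁ j<n = begin
    swap (to n) (v n) (to j)  ≡⟨ cong (swap (to n) (v n)) (π≡v j<n) ⟩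
    swap (to n) (v n) (v j)   ≡⟨ swap-other _ _ (v j) vj≢to-n (λ vj≡vn → <⇒≢ j<n (v-inj vj≡vn)) ⟩
    v j                       ∎
    where
    vj≢to-n : v j ≢ to n
    vj≢to-n vj≡to-n =
      <⇒≢ j<n (Injection.injective (↔⇒↣ π) (trans (π≡v j<n) vj≡to-n))

relabel : (G : Graph) → ℕ ↔ ℕ → Presentation G
relabel G π =
  record { adj     = λ x y → adj G (to x) (to y)
         ; adj-sym = λ x y → adj-sym G (to x) (to y)
         ; adj-irr = λ x → adj-irr G (to x) }
  , π , λ _ _ → refl
  where open Inverse π using (to)

constant-segment : (G : Graph) {b : Bool} {v : ℕ → ℕ} → Homogeneous (adj G) b v →
  ∀ n → Σ (Presentation G) λ α → restrict (proj₁ α) n ≡ code (λ _ _ → b) n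
constant-segment G hom n =
  let (π , π≡v) = placement _ (increasing⇒injective _ increasing) n
  in relabel G π , code-cong _ _ n λ i m i<m m<n → begin
       adj G (Inverse.to π i) (Inverse.to π m)
         ≡⟨ cong₂ (adj G) (π≡v (<-trans i<m m<n)) (π≡v m<n) ⟩
       adj G _ _
         ≡⟨ coloured i<m ⟩
       _ ∎
  where open Homogeneous hom

theorem4p6 : ExcludedMiddle 0ℓ → (G : Graph) (h : ℕ → ℕ) →
    OnlineComputable G h ⇔ PrimitiveRecursive h
theorem4p6 lem G h = mk⇔ online⇒pr pr⇒online
  where
  open Classical lem using (ramsey)

  -- Evaluate F on a presentation whose first u(i) vertices are homogeneous.
  online⇒pr : OnlineComputable G h → PrimitiveRecursive h
  online⇒pr (u , F , computes) =
    let (b , v , hom) = ramsey (adj G)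
    in app₂ F (app₁ (codeP b) u) #0 , λ i →
      let n = eval u (i ∷ [])
          (α , α↾n) = constant-segment G hom n
      in begin
        h i                                       ≡⟨ computes α i ⟩
        eval F (restrict (proj₁ α) n ∷ i ∷ [])    ≡⟨ cong (λ s → eval F (s ∷ i ∷ [])) α↾n ⟩
        eval F (code (λ _ _ → b) n ∷ i ∷ [])      ≡⟨ cong (λ s → eval F (s ∷ i ∷ [])) (codeP-ok b n) ⟨
        eval F (eval (codeP b) (n ∷ []) ∷ i ∷ []) ∎

  pr⇒online : PrimitiveRecursive h → OnlineComputable G h
  pr⇒online (c , computes) = zeroP , app₁ c #1 , λ _ i → computes i
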